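{- Let $a,b,c$ be integers and let $G_1,G_2$ be two $(a,b,c)$-free-choosable graphs. Then the graph obtained from $G_1$ and $G_2$ (taken vertex-disjoint) by identifying any vertex of $G_1$ with any vertex of $G_2$ is $(a,b,c)$-free-choosable.
   Context: All graphs are finite and simple. For integers $a\ge b\ge 1$ and $c\ge 0$: an $a$-list assignment of a graph $G$ is a function $L$ assigning to each vertex $v$ a set $L(v)$ of exactly $a$ integers (colors). It is $c$-separating if $|L(u)\cap L(v)|\le c$ for every edge $uv$. An $(L,b)$-coloring of $G$ is a function $\varphi$ assigning to each vertex $v$ a set $\varphi(v)\subseteq L(v)$ with $|\varphi(v)|=b$ such that $\varphi(u)\cap\varphi(v)=\emptyset$ for every edge $uv$. $G$ is $(a,b,c)$-free-choosable if for every $c$-separating $a$-list assignment $L$ of $G$, every vertex $v$ and every $C\subseteq L(v)$ with $|C|=b$, there exists an $(L,b)$-coloring $\varphi$ of $G$ with $\varphi(v)=C$. -}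

module Defs where

open import Level using (0ℓ)
open import Data.Nat using (ℕ; _≤_)
open import Data.Integer using (ℤ)
open import Data.Integer.Properties using () renaming (_≟_ to _≟ℤ_)
open import Data.List using (List; length; filter)
open import Data.List.Membership.Propositional using (_∈_)
open import Data.List.Membership.DecPropositional _≟ℤ_ using (_∈?_)
open import Data.List.Relation.Unary.Unique.Propositional using (Unique)
open import Data.List.Relation.Binary.Subset.Propositional using (_⊆_)
open import Data.Product using (Σ; _×_; _,_; proj₁; proj₂)
open import Data.Sum using (_⊎_; inj₁; inj₂)
open import Data.Empty using (⊥)
open import Relation.Nullary using (¬_; yes; no; Dec)
open import Relation.Binary.Definitions using (DecidableEquality)
open import Data.List using (_++_; map; [])
open import Data.List using (_∷_)
open import Data.List.Membership.Propositional.Properties using (∈-++⁺ˡ; ∈-++⁺ʳ; ∈-map⁺)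
open import Data.List.Relation.Unary.Any using (here; there)
open import Data.Sum.Properties using (≡-dec)
open import Data.Product.Properties using (Σ-≡,≡→≡)
open import Relation.Binary.PropositionalEquality using (refl; cong; subst)
open import Data.Empty using (⊥-elim; ⊥-elim-irr)
open import Data.Bool using (Bool; true; false; T; not)
open import Relation.Nullary.Decidable using (⌊_⌋)
open import Data.Unit using (tt)
open import Relation.Binary.PropositionalEquality using (_≡_; _≢_)

record Graph : Set₁ where
  field
    V      : Set
    enum   : List V
    complete : ∀ v → v ∈ enum
    _≟V_   : DecidableEquality V
    E      : V → V → Set
    sym    : ∀ {u v} → E u v → E v u
    irrefl : ∀ {v} → ¬ E v v

open Graph public

-- A finite set of colors (integers), represented by a duplicate-free list.
ColorSet : Set
ColorSet = List ℤ

∣_∩_∣ : ColorSet → ColorSet → ℕ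
∣ A ∩ B ∣ = length (filter (_∈? B) A)

IsListAssignment : (G : Graph) → ℕ → (V G → ColorSet) → Set
IsListAssignment G a L = ∀ v → Unique (L v) × length (L v) ≡ a

IsSeparating : (G : Graph) → ℕ → (V G → ColorSet) → Set
IsSeparating G c L = ∀ u v → E G u v → ∣ L u ∩ L v ∣ ≤ c

Disjoint : ColorSet → ColorSet → Set
Disjoint A B = ∀ {x} → x ∈ A → x ∈ B → ⊥

IsLbColoring : (G : Graph) → (V G → ColorSet) → ℕ → (V G → ColorSet) → Set
IsLbColoring G L b φ =
  (∀ v → (φ v ⊆ L v) × Unique (φ v) × length (φ v) ≡ b)
  × (∀ u v → E G u v → Disjoint (φ u) (φ v))

FreeChoosable : ℕ → ℕ → ℕ → Graph → Set
FreeChoosable a b c G =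
  ∀ (L : V G → ColorSet) → IsListAssignment G a L → IsSeparating G c L →
  ∀ (v : V G) (C : ColorSet) → C ⊆ L v → Unique C → length C ≡ b →
  Σ (V G → ColorSet) λ φ → IsLbColoring G L b φ × (φ v ⊆ C) × (C ⊆ φ v)

-- Glued graph: vertex-disjoint union of G₁ and G₂ with x₁ ∈ V G₁ identified
-- with x₂ ∈ V G₂.  Vertex set: V G₁ ⊎ (V G₂ ∖ {x₂}); the identified vertex
-- is represented by inj₁ x₁.  Edges of G₂ at x₂ become edges at x₁.
record Rest (G : Graph) (x : V G) : Set where
  constructor _,,_
  field
    vtx : V G
    .ne : vtx ≢ x
open Rest public

GlueV : (G₁ G₂ : Graph) → V G₂ → Set
GlueV G₁ G₂ x₂ = V G₁ ⊎ Rest G₂ x₂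

GlueE : (G₁ G₂ : Graph) (x₁ : V G₁) (x₂ : V G₂) → GlueV G₁ G₂ x₂ → GlueV G₁ G₂ x₂ → Set
GlueE G₁ G₂ x₁ x₂ (inj₁ u) (inj₁ v) = E G₁ u v
GlueE G₁ G₂ x₁ x₂ (inj₂ u) (inj₂ v) = E G₂ (vtx u) (vtx v)
GlueE G₁ G₂ x₁ x₂ (inj₁ u) (inj₂ v) = (u ≡ x₁) × E G₂ x₂ (vtx v)
GlueE G₁ G₂ x₁ x₂ (inj₂ u) (inj₁ v) = (v ≡ x₁) × E G₂ (vtx u) x₂

private
  restList : (G : Graph) (x : V G) → List (V G) → List (Rest G x)
  restList G x [] = []
  restList G x (w ∷ ws) with _≟V_ G w x
  ... | yes _ = restList G x ws
  ... | no w≢x = (w ,, w≢x) ∷ restList G x ws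

  restList-complete : (G : Graph) (x : V G) (ws : List (V G)) (r : Rest G x) →
    vtx r ∈ ws → r ∈ restList G x ws
  restList-complete G x (w ∷ ws) r (here refl) with _≟V_ G w x
  ... | yes w≡x = ⊥-elim (ne-elim r w≡x)
    where
    ne-elim : (r : Rest G x) → vtx r ≡ x → ⊥
    ne-elim (v ,, p) eq = ⊥-elim-irr (p eq)
  ... | no _ = here refl
  restList-complete G x (w ∷ ws) r (there m) with _≟V_ G w x
  ... | yes _ = restList-complete G x ws r m
  ... | no _ = there (restList-complete G x ws r m)

  restDec : (G : Graph) (x : V G) → DecidableEquality (Rest G x)
  restDec G x (u ,, p) (v ,, q) with _≟V_ G u v
  ... | no u≢v = no (λ eq → u≢v (cong vtx eq))
  ... | yes refl = yes refl

  glueSym : (G₁ G₂ : Graph) (x₁ : V G₁) (x₂ : V G₂) {u v : GlueV G₁ G₂ x₂} →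
    GlueE G₁ G₂ x₁ x₂ u v → GlueE G₁ G₂ x₁ x₂ v u
  glueSym G₁ G₂ x₁ x₂ {inj₁ u} {inj₁ v} e = sym G₁ e
  glueSym G₁ G₂ x₁ x₂ {inj₂ u} {inj₂ v} e = sym G₂ e
  glueSym G₁ G₂ x₁ x₂ {inj₁ u} {inj₂ v} (p , e) = p , sym G₂ e
  glueSym G₁ G₂ x₁ x₂ {inj₂ u} {inj₁ v} (p , e) = p , sym G₂ e

  glueIrr : (G₁ G₂ : Graph) (x₁ : V G₁) (x₂ : V G₂) {v : GlueV G₁ G₂ x₂} →
    ¬ GlueE G₁ G₂ x₁ x₂ v v
  glueIrr G₁ G₂ x₁ x₂ {inj₁ v} e = irrefl G₁ e
  glueIrr G₁ G₂ x₁ x₂ {inj₂ v} e = irrefl G₂ e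

  glueComplete : (G₁ G₂ : Graph) (x₂ : V G₂) (v : GlueV G₁ G₂ x₂) →
    v ∈ (map inj₁ (enum G₁) ++ map inj₂ (restList G₂ x₂ (enum G₂)))
  glueComplete G₁ G₂ x₂ (inj₁ v) = ∈-++⁺ˡ (∈-map⁺ inj₁ (complete G₁ v))
  glueComplete G₁ G₂ x₂ (inj₂ r) =
    ∈-++⁺ʳ (map inj₁ (enum G₁)) (∈-map⁺ inj₂ (restList-complete G₂ x₂ (enum G₂) r (complete G₂ (vtx r))))

glue : (G₁ G₂ : Graph) → V G₁ → V G₂ → Graph
glue G₁ G₂ x₁ x₂ = record
  { V = GlueV G₁ G₂ x₂
  ; enum = map inj₁ (enum G₁) ++ map inj₂ (restList G₂ x₂ (enum G₂))
  ; complete = glueComplete G₁ G₂ x₂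
  ; _≟V_ = ≡-dec (_≟V_ G₁) (restDec G₂ x₂)
  ; E = GlueE G₁ G₂ x₁ x₂
  ; sym = λ {u} {v} → glueSym G₁ G₂ x₁ x₂ {u} {v}
  ; irrefl = λ {v} → glueIrr G₁ G₂ x₁ x₂ {v}
  }

module Submission where

open import Defs
open import Data.Nat using (ℕ; _≤_)
open import Data.Sum using (inj₁; inj₂; [_,_])
open import Data.Product using (Σ; _×_; _,_; proj₁)
open import Data.Empty using (⊥-elim; ⊥-elim-irr)
open import Function using (_∘_)
open import Relation.Nullary using (yes; no)
open import Relation.Binary.PropositionalEquality using (_≡_; refl; subst) renaming (sym to ≡-sym)
open import Data.List.Relation.Binary.Subset.Propositional using (_⊆_)
open import Data.List.Relation.Unary.Unique.Propositional using (Unique)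
open import Data.List using (length)

Homomorphism : (H G : Graph) → (V H → V G) → Set
Homomorphism H G f = ∀ {u v} → E H u v → E G (f u) (f v)

Admissible : ℕ → ColorSet → ColorSet → Set
Admissible b A C = C ⊆ A × Unique C × length C ≡ b

listAssignment-∘ : ∀ (H G : Graph) {a L} (f : V H → V G) →
  IsListAssignment G a L → IsListAssignment H a (L ∘ f)
listAssignment-∘ H G f LA = LA ∘ f

separating-∘ : ∀ (H G : Graph) {c L} {f : V H → V G} → Homomorphism H G f →
  IsSeparating G c L → IsSeparating H c (L ∘ f)
separating-∘ H G {f = f} hom Sep u v e = Sep (f u) (f v) (hom e)

colorAlong : ∀ {a b c} (H G : Graph) {L : V G → ColorSet} (f : V H → V G) →
  FreeChoosable a b c H → Homomorphism H G f →
  IsListAssignment G a L → IsSeparating G c L →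
  ∀ v C → Admissible b (L (f v)) C →
  Σ (V H → ColorSet) λ φ → IsLbColoring H (L ∘ f) b φ × (φ v ⊆ C) × (C ⊆ φ v)
colorAlong H G {L} f F hom LA Sep v C (C⊆ , C! , ∣C∣) =
  F (L ∘ f) (listAssignment-∘ H G f LA) (separating-∘ H G {L = L} hom Sep) v C C⊆ C! ∣C∣

module _ (G₁ G₂ : Graph) (x₁ : V G₁) (x₂ : V G₂) where

  private
    G : Graph
    G = glue G₁ G₂ x₁ x₂

  ι₂ : V G₂ → V G
  ι₂ y with _≟V_ G₂ y x₂
  ... | yes _ = inj₁ x₁
  ... | no y≢x₂ = inj₂ (y ,, y≢x₂)

  ι₂-x₂ : ι₂ x₂ ≡ inj₁ x₁
  ι₂-x₂ with _≟V_ G₂ x₂ x₂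
  ... | yes _ = refl
  ... | no x₂≢x₂ = ⊥-elim (x₂≢x₂ refl)

  ι₂-vtx : ∀ r → ι₂ (vtx r) ≡ inj₂ r
  ι₂-vtx (y ,, y≢x₂) with _≟V_ G₂ y x₂
  ... | yes y≡x₂ = ⊥-elim-irr (y≢x₂ y≡x₂)
  ... | no _ = refl

  inj₁-homomorphism : Homomorphism G₁ G inj₁
  inj₁-homomorphism e = e

  ι₂-homomorphism : Homomorphism G₂ G ι₂
  ι₂-homomorphism {y} {z} e with _≟V_ G₂ y x₂ | _≟V_ G₂ z x₂
  ... | yes refl | yes refl = ⊥-elim (irrefl G₂ e)
  ... | yes refl | no _ = refl , e
  ... | no _ | yes refl = refl , e
  ... | no _ | no _ = e

  -- Containment at the glued vertex suffices: it is only used against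
  -- neighbours of x₂ in G₂.
  glueColoring : ∀ {b} {L : V G → ColorSet} {φ₁ φ₂} →
    IsLbColoring G₁ (L ∘ inj₁) b φ₁ → IsLbColoring G₂ (L ∘ ι₂) b φ₂ →
    φ₁ x₁ ⊆ φ₂ x₂ → IsLbColoring G L b [ φ₁ , φ₂ ∘ vtx ]
  glueColoring {b} {L} {φ₁} {φ₂} (adm₁ , disj₁) (adm₂ , disj₂) φ₁x₁⊆φ₂x₂ = adm , disj
    where
    adm : ∀ v → Admissible b (L v) ([ φ₁ , φ₂ ∘ vtx ] v)
    adm (inj₁ u) = adm₁ u
    adm (inj₂ r) = subst (λ w → Admissible b (L w) (φ₂ (vtx r))) (ι₂-vtx r) (adm₂ (vtx r))

    disj : ∀ u v → GlueE G₁ G₂ x₁ x₂ u v → Disjoint ([ φ₁ , φ₂ ∘ vtx ] u) ([ φ₁ , φ₂ ∘ vtx ] v)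
    disj (inj₁ u) (inj₁ v) e = disj₁ u v e
    disj (inj₂ r) (inj₂ s) e = disj₂ (vtx r) (vtx s) e
    disj (inj₁ _) (inj₂ s) (refl , e) i∈ i∈′ = disj₂ x₂ (vtx s) e (φ₁x₁⊆φ₂x₂ i∈) i∈′
    disj (inj₂ r) (inj₁ _) (refl , e) i∈ i∈′ = disj₂ (vtx r) x₂ e i∈ (φ₁x₁⊆φ₂x₂ i∈′)

  -- Precolor the side containing the given vertex, then extend to the other
  -- side by precoloring the glued vertex with the colors it has just received.
  glue-freeChoosable : ∀ {a b c} → FreeChoosable a b c G₁ → FreeChoosable a b c G₂ →
    FreeChoosable a b c G
  glue-freeChoosable {b = b} F₁ F₂ L LA Sep (inj₁ w) C C⊆ C! ∣C∣
    with φ₁ , col₁ , φ₁w⊆C , C⊆φ₁w ←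
           colorAlong G₁ G inj₁ F₁ inj₁-homomorphism LA Sep w C (C⊆ , C! , ∣C∣)
    with φ₂ , col₂ , _ , φ₁x₁⊆φ₂x₂ ←
           colorAlong G₂ G ι₂ F₂ ι₂-homomorphism LA Sep x₂ (φ₁ x₁)
             (subst (λ u → Admissible b (L u) (φ₁ x₁)) (≡-sym ι₂-x₂) (proj₁ col₁ x₁))
    = [ φ₁ , φ₂ ∘ vtx ] , glueColoring col₁ col₂ φ₁x₁⊆φ₂x₂ , φ₁w⊆C , C⊆φ₁w
  glue-freeChoosable {b = b} F₁ F₂ L LA Sep (inj₂ r) C C⊆ C! ∣C∣
    with φ₂ , col₂ , φ₂r⊆C , C⊆φ₂r ←
           colorAlong G₂ G ι₂ F₂ ι₂-homomorphism LA Sep (vtx r) C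
             (subst (λ u → C ⊆ L u) (≡-sym (ι₂-vtx r)) C⊆ , C! , ∣C∣)
    with φ₁ , col₁ , φ₁x₁⊆φ₂x₂ , _ ←
           colorAlong G₁ G inj₁ F₁ inj₁-homomorphism LA Sep x₁ (φ₂ x₂)
             (subst (λ u → Admissible b (L u) (φ₂ x₂)) ι₂-x₂ (proj₁ col₂ x₂))
    = [ φ₁ , φ₂ ∘ vtx ] , glueColoring col₁ col₂ φ₁x₁⊆φ₂x₂ , φ₂r⊆C , C⊆φ₂r

lemma3 : (a b c : ℕ) → b ≤ a → 1 ≤ b →
         (G₁ G₂ : Graph) → FreeChoosable a b c G₁ → FreeChoosable a b c G₂ →
         (x₁ : V G₁) (x₂ : V G₂) → FreeChoosable a b c (glue G₁ G₂ x₁ x₂)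
lemma3 a b c _ _ G₁ G₂ F₁ F₂ x₁ x₂ = glue-freeChoosable G₁ G₂ x₁ x₂ F₁ F₂
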